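{- For all $n\ge1$, \[a_n(132,\emptyset,\{3\})=a_n(132,\emptyset,\{1,3\})=\sum_{k=1}^{n}(k-1)!\,(n-k)!.\]
   Context: A bi-vincular pattern of length $k$ is a triple $p=(\sigma,X,Y)$ with $\sigma$ a permutation of $[k]$ in one-line notation and $X,Y\subseteq\{0,1,\dots,k\}$. A permutation $\pi=\pi_1\cdots\pi_n$ of $[n]$ contains $p$ if there are indices $1\le i_1<\dots<i_k\le n$ such that $(\pi_{i_1},\dots,\pi_{i_k})$ is order-isomorphic to $\sigma$ and, writing $j_1<\dots<j_k$ for the set $\{\pi_{i_1},\dots,\pi_{i_k}\}$ in increasing order and setting $i_0=j_0=0$, $i_{k+1}=j_{k+1}=n+1$, we have $i_{x+1}=i_x+1$ for all $x\in X$ and $j_{y+1}=j_y+1$ for all $y\in Y$. Otherwise $\pi$ avoids $p$; $a_n(p)$ is the number of permutations of $[n]$ avoiding $p$. -}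

module Defs where

open import Data.Bool using (Bool; true; false; _∧_; _∨_; not; if_then_else_)
open import Data.Nat using (ℕ; zero; suc; _+_; _*_; _∸_; _<ᵇ_; _≡ᵇ_; _≤ᵇ_; _!)
open import Data.List using (List; []; _∷_; _++_; [_]; map; concatMap; upTo; filterᵇ; length)
open import Data.Bool.ListAction using (all; any)
open import Data.Nat.ListAction using (sum)

-- Conventions: permutations of [n] are words π₁⋯πₙ over {1,…,n} (lists of ℕ)
-- in which every value 1..n occurs.  Positions and values are 1-based, exactly
-- as in the paper.

oneTo : ℕ → List ℕ
oneTo n = map suc (upTo n)

-- 0-based list access with default 0
at : List ℕ → ℕ → ℕ
at []       _       = 0
at (x ∷ xs) zero    = x
at (x ∷ xs) (suc i) = at xs i

pos : List ℕ → ℕ → ℕ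
pos π i = at π (i ∸ 1)

words : ℕ → ℕ → List (List ℕ)
words zero    n = [] ∷ []
words (suc l) n = concatMap (λ w → map (λ a → a ∷ w) (oneTo n)) (words l n)

isPermOf : ℕ → List ℕ → Bool
isPermOf n w = (length w ≡ᵇ n) ∧ all (λ v → any (λ a → a ≡ᵇ v) w) (oneTo n)

perms : ℕ → List (List ℕ)
perms n = filterᵇ (isPermOf n) (words n n)

combs : ℕ → List ℕ → List (List ℕ)
combs zero    _        = [] ∷ []
combs (suc k) []       = []
combs (suc k) (x ∷ xs) = map (x ∷_) (combs k xs) ++ combs (suc k) xs

insert : ℕ → List ℕ → List ℕ
insert x []       = x ∷ []
insert x (y ∷ ys) = if x ≤ᵇ y then x ∷ y ∷ ys else y ∷ insert x ys

sortℕ : List ℕ → List ℕ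
sortℕ []       = []
sortℕ (x ∷ xs) = insert x (sortℕ xs)

_==_ : Bool → Bool → Bool
true  == b = b
false == b = not b

orderIso : List ℕ → List ℕ → Bool
orderIso u σ = (length u ≡ᵇ length σ) ∧
  all (λ a → all (λ b → (at u a <ᵇ at u b) == (at σ a <ᵇ at σ b)) (upTo (length σ))) (upTo (length σ))

record BiVincular : Set where
  constructor bivinc
  field
    σ : List ℕ
    X : List ℕ
    Y : List ℕ

-- "ext" c n = c₀ c₁ … c_k c_{k+1} with c₀ = 0, c_{k+1} = n+1; entry x is (ext c n) at x.
ext : List ℕ → ℕ → List ℕ
ext c n = 0 ∷ c ++ [ suc n ]

adjacentAt : List ℕ → ℕ → Bool
adjacentAt e x = at e (suc x) ≡ᵇ suc (at e x)

contains : ℕ → List ℕ → BiVincular → Bool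
contains n π (bivinc σ X Y) =
  any (λ is →
        let vals = map (pos π) is
            iE   = ext is n
            jE   = ext (sortℕ vals) n
        in orderIso vals σ ∧ all (adjacentAt iE) X ∧ all (adjacentAt jE) Y)
      (combs (length σ) (oneTo n))

avoidCount : ℕ → BiVincular → ℕ
avoidCount n p = length (filterᵇ (λ π → not (contains n π p)) (perms n))

rhsSum : ℕ → ℕ
rhsSum n = sum (map (λ k → ((k ∸ 1) !) * ((n ∸ k) !)) (oneTo n))

p132-3 : BiVincular
p132-3 = bivinc (1 ∷ 3 ∷ 2 ∷ []) [] (3 ∷ [])

p132-13 : BiVincular
p132-13 = bivinc (1 ∷ 3 ∷ 2 ∷ []) [] (1 ∷ 3 ∷ [])

open import Relation.Binary.PropositionalEquality using (_≡_; refl)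
private
  t1 : map (λ n → avoidCount n p132-3) (1 ∷ 2 ∷ 3 ∷ 4 ∷ []) ≡ map rhsSum (1 ∷ 2 ∷ 3 ∷ 4 ∷ [])
  t1 = refl
  t2 : map (λ n → avoidCount n p132-13) (1 ∷ 2 ∷ 3 ∷ 4 ∷ []) ≡ map rhsSum (1 ∷ 2 ∷ 3 ∷ 4 ∷ [])
  t2 = refl
  t3 : avoidCount 4 (bivinc (1 ∷ 3 ∷ 2 ∷ []) [] []) ≡ 14
  t3 = refl
  t4 : length (perms 4) ≡ 24
  t4 = refl

module Submission where

-- Since its '3' must be the value n (Y = {3}), a permutation w of [n] contains (132, ∅, {3})
-- iff some entry left of n is smaller than some entry right of n. Hence w = α ++ n ∷ β avoids
-- it iff every entry of α exceeds every entry of β, i.e. (by Cut.cut) iff α is an arrangement of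
-- the top block [|β|+1 .. n−1] and β one of the bottom block [1 .. |β|]. Sorting the avoiders by
-- the position k of n and counting arrangements with the product rule gives (k−1)!·(n−k)!
-- avoiders with n at position k.  For (132, ∅, {1,3}) one shows that the two patterns have the
-- same avoiders: an occurrence x … n … z of the first can be tightened, by following the value
-- x + 1, until z = x + 1.

open import Defs

open import Data.Bool using (Bool; true; false; _∧_; not; T; T?)
open import Data.Bool.ListAction using (all; any)
open import Data.Bool.Properties using (T-∧)
open import Data.Empty using (⊥-elim)
open import Data.List using (List; []; _∷_; _++_; [_]; map; concatMap; filter; filterᵇ; length; take; drop; applyUpTo; upTo)
open import Data.List.Properties using (map-++; length-++; map-upTo; length-map; length-upTo; take++drop≡id; ∷-injectiveˡ; ∷-injectiveʳ)
open import Data.List.Membership.Propositional using (_∈_; _∉_; find; lose)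
open import Data.List.Membership.Propositional.Properties using (∈-map⁻; ∈-map⁺; ∈-upTo⁻; ∈-upTo⁺; ∈-filter⁺; ∈-filter⁻; ∈-∃++; ∈-++⁻; ∈-++⁺ˡ; ∈-++⁺ʳ)
open import Data.List.Relation.Binary.Subset.Propositional using (_⊆_)
open import Data.List.Relation.Binary.Sublist.Propositional using ([]; _∷_; _∷ʳ_; minimum) renaming (_⊆_ to _⊑_)
open import Data.List.Relation.Unary.All as All using (All; []; _∷_)
open import Data.List.Relation.Unary.All.Properties using (all⁺; all⁻)
open import Data.List.Relation.Unary.Any as Any using (here; there)
open import Data.List.Relation.Unary.Any.Properties using (any⁺; any⁻)
open import Data.List.Relation.Unary.Linked using (Linked; [-]; _∷_)
open import Data.List.Relation.Unary.Unique.Propositional using (Unique; []; _∷_)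
import Data.List.Relation.Unary.Unique.Propositional.Properties as Unique
open import Data.Nat using (ℕ; zero; suc; _+_; _*_; _∸_; _≡ᵇ_; _<ᵇ_; _!; _≤_; _<_; _≥_; z≤n; s≤s; _≟_; _≤?_; pred)
open import Data.Nat.ListAction using (sum)
open import Data.Nat.ListAction.Properties using (sum-++)
open import Data.Nat.Properties
open import Algebra.Properties.CommutativeSemigroup +-commutativeSemigroup using (interchange)
open import Data.List.Membership.DecPropositional _≟_ using (_∈?_)
open import Data.Product using (_×_; _,_; proj₁; proj₂; ∃)
open import Data.Sum using (_⊎_; inj₁; inj₂)
open import Function using (_∘_; Equivalence)
open import Relation.Binary using (tri<; tri≈; tri>)
open import Relation.Binary.PropositionalEquality using (_≡_; _≢_; refl; sym; trans; cong; cong₂; subst; subst₂; module ≡-Reasoning)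
open import Relation.Nullary using (¬_; yes; no; ¬?)

∧⁻ : ∀ {x y} → T (x ∧ y) → T x × T y
∧⁻ {x} {y} = Equivalence.to (T-∧ {x} {y})

∧⁺ : ∀ {x y} → T x → T y → T (x ∧ y)
∧⁺ {x} {y} p q = Equivalence.from (T-∧ {x} {y}) (p , q)

T-ext : ∀ {x y} → (T x → T y) → (T y → T x) → x ≡ y
T-ext {true}  {true}  _ _ = refl
T-ext {true}  {false} f _ = ⊥-elim (f _)
T-ext {false} {true}  _ g = ⊥-elim (g _)
T-ext {false} {false} _ _ = refl

T-true : ∀ {b} → T b → b ≡ true
T-true {true} _ = refl

T-false : ∀ {b} → ¬ T b → b ≡ false
T-false {true}  ¬t = ⊥-elim (¬t _)
T-false {false} _  = refl

T-not : ∀ {b} → ¬ T b → T (not b)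
T-not {true}  ¬t = ¬t _
T-not {false} _  = _

T-not⁻ : ∀ {b} → T (not b) → ¬ T b
T-not⁻ {true} () _

<ᵇ-true : ∀ {m n} → m < n → (m <ᵇ n) ≡ true
<ᵇ-true m<n = T-true (<⇒<ᵇ m<n)

<ᵇ-false : ∀ {m n} → n ≤ m → (m <ᵇ n) ≡ false
<ᵇ-false {m} {n} n≤m = T-false (λ t → <⇒≱ (<ᵇ⇒< m n t) n≤m)

ind : Bool → ℕ
ind true  = 1
ind false = 0

ind-true : ∀ {b} → T b → ind b ≡ 1
ind-true {true} _ = refl

ind-false : ∀ {b} → ¬ T b → ind b ≡ 0
ind-false {true}  ¬t = ⊥-elim (¬t _)
ind-false {false} _  = refl

memb : ℕ → List ℕ → Bool
memb x S = any (λ y → y ≡ᵇ x) S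

memb⁻ : ∀ {x} S → T (memb x S) → x ∈ S
memb⁻ {x} S t = Any.map (λ {y} e → sym (≡ᵇ⇒≡ y x e)) (any⁻ _ S t)

memb⁺ : ∀ {x} S → x ∈ S → T (memb x S)
memb⁺ {x} S x∈S = any⁺ _ (Any.map (λ {y} e → ≡⇒≡ᵇ y x (sym e)) x∈S)

sumOver : {A : Set} → List A → (A → ℕ) → ℕ
sumOver xs f = sum (map f xs)

private variable A B : Set

length-filter : (p : A → Bool) (xs : List A) → length (filterᵇ p xs) ≡ sumOver xs (ind ∘ p)
length-filter p [] = refl
length-filter p (x ∷ xs) with p x
... | true  = cong suc (length-filter p xs)
... | false = length-filter p xs

length-filter² : (p q : A → Bool) (xs : List A) →
  length (filterᵇ q (filterᵇ p xs)) ≡ sumOver xs (λ x → ind (p x ∧ q x))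
length-filter² p q [] = refl
length-filter² p q (x ∷ xs) with p x
... | false = length-filter² p q xs
... | true with q x
...   | true  = cong suc (length-filter² p q xs)
...   | false = length-filter² p q xs

sumOver-cong : (xs : List A) {f g : A → ℕ} → (∀ {x} → x ∈ xs → f x ≡ g x) → sumOver xs f ≡ sumOver xs g
sumOver-cong []       _  = refl
sumOver-cong (x ∷ xs) eq = cong₂ _+_ (eq (here refl)) (sumOver-cong xs (eq ∘ there))

sumOver-zero : (xs : List A) {f : A → ℕ} → (∀ {x} → x ∈ xs → f x ≡ 0) → sumOver xs f ≡ 0
sumOver-zero []       _  = refl
sumOver-zero (x ∷ xs) eq = cong₂ _+_ (eq (here refl)) (sumOver-zero xs (eq ∘ there))

sumOver-++ : (xs ys : List A) (f : A → ℕ) → sumOver (xs ++ ys) f ≡ sumOver xs f + sumOver ys f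
sumOver-++ xs ys f = trans (cong sum (map-++ f xs ys)) (sum-++ (map f xs) (map f ys))

sumOver-+ : (xs : List A) (f g : A → ℕ) → sumOver xs (λ x → f x + g x) ≡ sumOver xs f + sumOver xs g
sumOver-+ []       f g = refl
sumOver-+ (x ∷ xs) f g =
  trans (cong (f x + g x +_) (sumOver-+ xs f g)) (interchange (f x) (g x) (sumOver xs f) (sumOver xs g))

sumOver-*ʳ : (xs : List A) (f : A → ℕ) (c : ℕ) → sumOver xs (λ x → f x * c) ≡ sumOver xs f * c
sumOver-*ʳ []       f c = refl
sumOver-*ʳ (x ∷ xs) f c =
  trans (cong (f x * c +_) (sumOver-*ʳ xs f c)) (sym (*-distribʳ-+ c (f x) (sumOver xs f)))

sumOver-swap : (xs : List A) (ys : List B) (F : A → B → ℕ) →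
  sumOver xs (λ x → sumOver ys (F x)) ≡ sumOver ys (λ y → sumOver xs (λ x → F x y))
sumOver-swap []       ys F = sym (sumOver-zero ys (λ _ → refl))
sumOver-swap (x ∷ xs) ys F =
  trans (cong (sumOver ys (F x) +_) (sumOver-swap xs ys F))
        (sym (sumOver-+ ys (F x) (λ y → sumOver xs (λ x′ → F x′ y))))

sumOver-concatMap : (g : A → List B) (xs : List A) (f : B → ℕ) →
  sumOver (concatMap g xs) f ≡ sumOver xs (λ x → sumOver (g x) f)
sumOver-concatMap g []       f = refl
sumOver-concatMap g (x ∷ xs) f =
  trans (sumOver-++ (g x) (concatMap g xs) f) (cong (sumOver (g x) f +_) (sumOver-concatMap g xs f))

sumOver-map : (h : A → B) (xs : List A) (f : B → ℕ) → sumOver (map h xs) f ≡ sumOver xs (f ∘ h)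
sumOver-map h []       f = refl
sumOver-map h (x ∷ xs) f = cong (f (h x) +_) (sumOver-map h xs f)

sumOver-single : ∀ (P : ℕ → Bool) {xs m} → Unique xs → m ∈ xs → T (P m) → (∀ {k} → k ∈ xs → T (P k) → k ≡ m) →
  sumOver xs (ind ∘ P) ≡ 1
sumOver-single P {x ∷ xs} (x∉ ∷ _) (here refl) Pm only =
  cong₂ _+_ (ind-true Pm) (sumOver-zero xs (λ k∈ → ind-false (λ Pk → All.lookup x∉ k∈ (sym (only (there k∈) Pk)))))
sumOver-single P {x ∷ xs} (x∉ ∷ u) (there m∈) Pm only =
  cong₂ _+_ (ind-false (λ Px → All.lookup x∉ (subst (_∈ xs) (sym (only (here refl) Px)) m∈) refl))
            (sumOver-single P u m∈ Pm (only ∘ there))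

sumWords : ℕ → ℕ → (List ℕ → ℕ) → ℕ
sumWords n l f = sumOver (words l n) f

sumWords-suc : ∀ n l f → sumWords n (suc l) f ≡ sumOver (oneTo n) (λ a → sumWords n l (λ w → f (a ∷ w)))
sumWords-suc n l f = begin
  sumOver (concatMap (λ w → map (_∷ w) (oneTo n)) (words l n)) f
    ≡⟨ sumOver-concatMap (λ w → map (_∷ w) (oneTo n)) (words l n) f ⟩
  sumOver (words l n) (λ w → sumOver (map (_∷ w) (oneTo n)) f)
    ≡⟨ sumOver-cong (words l n) (λ {w} _ → sumOver-map (_∷ w) (oneTo n) f) ⟩
  sumOver (words l n) (λ w → sumOver (oneTo n) (λ a → f (a ∷ w)))
    ≡⟨ sumOver-swap (words l n) (oneTo n) (λ w a → f (a ∷ w)) ⟩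
  sumOver (oneTo n) (λ a → sumWords n l (λ w → f (a ∷ w)))  ∎
  where open ≡-Reasoning

Letter : ℕ → ℕ → Set
Letter n x = 1 ≤ x × x ≤ n

∈-oneTo⁻ : ∀ {n a} → a ∈ oneTo n → Letter n a
∈-oneTo⁻ m with _ , i∈ , refl ← ∈-map⁻ suc m = s≤s z≤n , ∈-upTo⁻ i∈

sumWords-cong : ∀ n l {f g : List ℕ → ℕ} →
  (∀ w → length w ≡ l → All (Letter n) w → f w ≡ g w) → sumWords n l f ≡ sumWords n l g
sumWords-cong n zero    eq = cong (_+ 0) (eq [] refl [])
sumWords-cong n (suc l) {f} {g} eq = begin
  sumWords n (suc l) f
    ≡⟨ sumWords-suc n l f ⟩
  sumOver (oneTo n) (λ a → sumWords n l (λ w → f (a ∷ w)))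
    ≡⟨ sumOver-cong (oneTo n) (λ a∈ → sumWords-cong n l (λ w len ls → eq _ (cong suc len) (∈-oneTo⁻ a∈ ∷ ls))) ⟩
  sumOver (oneTo n) (λ a → sumWords n l (λ w → g (a ∷ w)))
    ≡⟨ sumWords-suc n l g ⟨
  sumWords n (suc l) g  ∎
  where open ≡-Reasoning

sumWords-product : ∀ n a b (P Q : List ℕ → Bool) →
  sumWords n (a + b) (λ w → ind (P (take a w) ∧ Q (drop a w))) ≡ sumWords n a (ind ∘ P) * sumWords n b (ind ∘ Q)
sumWords-product n zero b P Q with P []
... | true  = sym (+-identityʳ _)
... | false = sumOver-zero (words b n) (λ _ → refl)
sumWords-product n (suc a) b P Q = begin
  sumWords n (suc a + b) (λ w → ind (P (take (suc a) w) ∧ Q (drop (suc a) w)))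
    ≡⟨ sumWords-suc n (a + b) _ ⟩
  sumOver (oneTo n) (λ c → sumWords n (a + b) (λ w → ind (P (c ∷ take a w) ∧ Q (drop a w))))
    ≡⟨ sumOver-cong (oneTo n) (λ {c} _ → sumWords-product n a b (P ∘ (c ∷_)) Q) ⟩
  sumOver (oneTo n) (λ c → sumWords n a (ind ∘ P ∘ (c ∷_)) * sumWords n b (ind ∘ Q))
    ≡⟨ sumOver-*ʳ (oneTo n) (λ c → sumWords n a (ind ∘ P ∘ (c ∷_))) _ ⟩
  sumOver (oneTo n) (λ c → sumWords n a (ind ∘ P ∘ (c ∷_))) * sumWords n b (ind ∘ Q)
    ≡⟨ cong (_* sumWords n b (ind ∘ Q)) (sumWords-suc n a (ind ∘ P)) ⟨
  sumWords n (suc a) (ind ∘ P) * sumWords n b (ind ∘ Q)  ∎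
  where open ≡-Reasoning

rem : ℕ → List ℕ → List ℕ
rem a = filter (λ y → ¬? (y ≟ a))

∈-rem⁻ : ∀ {a y} S → y ∈ rem a S → y ∈ S × y ≢ a
∈-rem⁻ {a} S = ∈-filter⁻ (λ y → ¬? (y ≟ a))

∈-rem⁺ : ∀ {a y} S → y ∈ S → y ≢ a → y ∈ rem a S
∈-rem⁺ {a} S = ∈-filter⁺ (λ y → ¬? (y ≟ a))

rem-Unique : ∀ {a S} → Unique S → Unique (rem a S)
rem-Unique {a} = Unique.filter⁺ (λ y → ¬? (y ≟ a))

∈-delete-middle : ∀ {y z : ℕ} xs {ys} → z ∈ xs ++ y ∷ ys → z ≢ y → z ∈ xs ++ ys
∈-delete-middle []       (here z≡y)  z≢y = ⊥-elim (z≢y z≡y)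
∈-delete-middle []       (there z∈)  _   = z∈
∈-delete-middle (_ ∷ xs) (here refl) _   = here refl
∈-delete-middle (_ ∷ xs) (there z∈)  z≢y = there (∈-delete-middle xs z∈ z≢y)

∈-insert-middle : ∀ {y z : ℕ} xs {ys} → z ∈ xs ++ ys → z ∈ xs ++ y ∷ ys
∈-insert-middle []       z∈          = there z∈
∈-insert-middle (_ ∷ xs) (here refl) = here refl
∈-insert-middle (_ ∷ xs) (there z∈)  = there (∈-insert-middle xs z∈)

Unique-⊆-length : ∀ {ys xs : List ℕ} → Unique ys → ys ⊆ xs → length ys ≤ length xs
Unique-⊆-length [] _ = z≤n
Unique-⊆-length {y ∷ ys} (y∉ys ∷ u) sub with xs₁ , xs₂ , refl ← ∈-∃++ (sub (here refl)) =
  subst (suc (length ys) ≤_) (sym length-middle) (s≤s (Unique-⊆-length u ys⊆))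
  where
  length-middle : length (xs₁ ++ y ∷ xs₂) ≡ suc (length (xs₁ ++ xs₂))
  length-middle = trans (length-++ xs₁) (trans (+-suc _ _) (cong suc (sym (length-++ xs₁))))
  ys⊆ : ys ⊆ xs₁ ++ xs₂
  ys⊆ z∈ys = ∈-delete-middle xs₁ (sub (there z∈ys)) (λ z≡y → All.lookup y∉ys z∈ys (sym z≡y))

Unique-same-length : ∀ {xs ys : List ℕ} → Unique xs → Unique ys → xs ⊆ ys → ys ⊆ xs → length xs ≡ length ys
Unique-same-length ux uy xs⊆ys ys⊆xs = ≤-antisym (Unique-⊆-length ux xs⊆ys) (Unique-⊆-length uy ys⊆xs)

length-rem : ∀ {a S} → Unique S → a ∈ S → length S ≡ suc (length (rem a S))
length-rem {a} {S} u a∈S = Unique-same-length u (a∉rem ∷ rem-Unique u) S⊆ a∷rem⊆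
  where
  a∉rem : All (a ≢_) (rem a S)
  a∉rem = All.tabulate (λ y∈ a≡y → proj₂ (∈-rem⁻ S y∈) (sym a≡y))
  S⊆ : S ⊆ a ∷ rem a S
  S⊆ {y} y∈S with y ≟ a
  ... | yes refl = here refl
  ... | no  y≢a  = there (∈-rem⁺ S y∈S y≢a)
  a∷rem⊆ : a ∷ rem a S ⊆ S
  a∷rem⊆ (here refl) = a∈S
  a∷rem⊆ (there y∈)  = proj₁ (∈-rem⁻ S y∈)

∈-tail : ∀ {x z : ℕ} {xs} → z ∈ x ∷ xs → z ≢ x → z ∈ xs
∈-tail (here z≡x) z≢x = ⊥-elim (z≢x z≡x)
∈-tail (there z∈) _   = z∈

covering-Unique : ∀ {ys : List ℕ} xs → Unique ys → ys ⊆ xs → length xs ≤ length ys → Unique xs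
covering-Unique []       _  _   _  = []
covering-Unique {ys} (x ∷ xs) uy ys⊆ len≤ with x ∈? ys
... | no x∉ys = ⊥-elim (<⇒≱ len≤ (Unique-⊆-length uy (λ z∈ys → ∈-tail (ys⊆ z∈ys) (λ { refl → x∉ys z∈ys }))))
... | yes x∈ys = All.tabulate x∉xs ∷ covering-Unique xs (rem-Unique uy) rem⊆ len≤′
  where
  rem⊆ : rem x ys ⊆ xs
  rem⊆ z∈ = ∈-tail (ys⊆ (proj₁ (∈-rem⁻ ys z∈))) (proj₂ (∈-rem⁻ ys z∈))
  len≤′ : length xs ≤ length (rem x ys)
  len≤′ = ≤-pred (subst (suc (length xs) ≤_) (length-rem uy x∈ys) len≤)
  x∉xs : ∀ {y} → y ∈ xs → x ≢ y
  x∉xs y∈xs refl = <⇒≱ len≤ (Unique-⊆-length uy (absorb ∘ ys⊆))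
    where
    absorb : x ∷ xs ⊆ xs
    absorb (here refl) = y∈xs
    absorb (there z∈)  = z∈

oneTo-Unique : ∀ n → Unique (oneTo n)
oneTo-Unique n = Unique.map⁺ suc-injective (Unique.upTo⁺ n)

Unique-middle : ∀ α {y : ℕ} β → Unique (α ++ y ∷ β) → y ∉ α × y ∉ β × (∀ {x} → x ∈ α → x ∉ β)
Unique-middle []      β (y∉β ∷ _) = (λ ()) , (λ y∈β → All.lookup y∉β y∈β refl) , λ ()
Unique-middle (a ∷ α) β (a∉ ∷ u) with y∉α , y∉β , disjoint ← Unique-middle α β u = y∉a∷α , y∉β , disjoint′
  where
  y∉a∷α : _ ∉ a ∷ α
  y∉a∷α (here refl) = All.lookup a∉ (∈-++⁺ʳ α (here refl)) refl
  y∉a∷α (there y∈α) = y∉α y∈α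
  disjoint′ : ∀ {x} → x ∈ a ∷ α → x ∉ β
  disjoint′ (here refl) x∈β = All.lookup a∉ (∈-++⁺ʳ α (there x∈β)) refl
  disjoint′ (there x∈α)     = disjoint x∈α

first-occurrence : ∀ {y : ℕ} α α′ {β β′} → y ∉ α → y ∉ α′ → α ++ y ∷ β ≡ α′ ++ y ∷ β′ → length α ≡ length α′
first-occurrence []      []        _    _     _  = refl
first-occurrence []      (x′ ∷ α′) _    y∉α′ eq = ⊥-elim (y∉α′ (here (∷-injectiveˡ eq)))
first-occurrence (x ∷ α) []        y∉α _     eq = ⊥-elim (y∉α (here (sym (∷-injectiveˡ eq))))
first-occurrence (x ∷ α) (x′ ∷ α′) y∉α y∉α′ eq =
  cong suc (first-occurrence α α′ (y∉α ∘ there) (y∉α′ ∘ there) (∷-injectiveʳ eq))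

-- interval lo c lists lo+1, lo+2, …, lo+c
interval : ℕ → ℕ → List ℕ
interval lo zero    = []
interval lo (suc c) = suc lo ∷ interval (suc lo) c

length-interval : ∀ lo c → length (interval lo c) ≡ c
length-interval lo zero    = refl
length-interval lo (suc c) = cong suc (length-interval (suc lo) c)

∈-interval⁻ : ∀ {x} lo c → x ∈ interval lo c → lo < x × x ≤ lo + c
∈-interval⁻ lo (suc c) (here refl) = ≤-refl , subst (suc lo ≤_) (sym (+-suc lo c)) (s≤s (m≤m+n lo c))
∈-interval⁻ lo (suc c) (there x∈) with lo<x , x≤ ← ∈-interval⁻ (suc lo) c x∈ =
  <-trans (n<1+n lo) lo<x , ≤-trans x≤ (≤-reflexive (sym (+-suc lo c)))

∈-interval⁺ : ∀ {x} lo c → lo < x → x ≤ lo + c → x ∈ interval lo c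
∈-interval⁺ {x} lo zero    lo<x x≤ = ⊥-elim (<⇒≱ lo<x (subst (x ≤_) (+-identityʳ lo) x≤))
∈-interval⁺ {x} lo (suc c) lo<x x≤ with x ≟ suc lo
... | yes refl = here refl
... | no  x≢   = there (∈-interval⁺ (suc lo) c (≤∧≢⇒< lo<x (x≢ ∘ sym)) (subst (x ≤_) (+-suc lo c) x≤))

interval-Unique : ∀ lo c → Unique (interval lo c)
interval-Unique lo zero    = []
interval-Unique lo (suc c) =
  All.tabulate (λ x∈ e → <-irrefl e (proj₁ (∈-interval⁻ (suc lo) c x∈))) ∷ interval-Unique (suc lo) c

oneTo-interval : ∀ n → oneTo n ≡ interval 0 n
oneTo-interval n = trans (map-upTo suc n) (applyUpTo-interval suc 0 n (λ _ → refl))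
  where
  applyUpTo-interval : ∀ (f : ℕ → ℕ) lo c → (∀ i → f i ≡ suc (lo + i)) → applyUpTo f c ≡ interval lo c
  applyUpTo-interval f lo zero    eq = refl
  applyUpTo-interval f lo (suc c) eq = cong₂ _∷_ (trans (eq 0) (cong suc (+-identityʳ lo)))
    (applyUpTo-interval (f ∘ suc) (suc lo) c (λ i → trans (eq (suc i)) (cong suc (+-suc lo i))))

∈-oneTo⁺ : ∀ {n x} → Letter n x → x ∈ oneTo n
∈-oneTo⁺ {n} {x} (0<x , x≤n) = subst (x ∈_) (sym (oneTo-interval n)) (∈-interval⁺ 0 n 0<x x≤n)

-- u lists the elements of S, each exactly once
Arrangement : List ℕ → List ℕ → Set
Arrangement S u = length u ≡ length S × u ⊆ S × S ⊆ u

isArrangement : List ℕ → List ℕ → Bool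
isArrangement S u = (length u ≡ᵇ length S) ∧ (all (λ x → memb x S) u ∧ all (λ s → memb s u) S)

isArrangement⁻ : ∀ S u → T (isArrangement S u) → Arrangement S u
isArrangement⁻ S u t with len , rest ← ∧⁻ t with u⊆ , S⊆ ← ∧⁻ {all _ u} rest =
  ≡ᵇ⇒≡ _ _ len , memb⁻ S ∘ All.lookup (all⁺ _ u u⊆) , memb⁻ u ∘ All.lookup (all⁺ _ S S⊆)

isArrangement⁺ : ∀ S u → Arrangement S u → T (isArrangement S u)
isArrangement⁺ S u (len , u⊆ , S⊆) =
  ∧⁺ (≡⇒≡ᵇ _ _ len) (∧⁺ (all⁻ _ (All.tabulate (memb⁺ S ∘ u⊆))) (all⁻ _ (All.tabulate (memb⁺ u ∘ S⊆))))

arrangement-∷⁻ : ∀ {S a u} → Unique S → Arrangement S (a ∷ u) → a ∈ S × Arrangement (rem a S) u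
arrangement-∷⁻ {S} {a} {u} uS (len , a∷u⊆S , S⊆a∷u) = a∈S , len′ , u⊆ , rem⊆
  where
  a∈S : a ∈ S
  a∈S = a∷u⊆S (here refl)
  a∉u : a ∉ u
  a∉u a∈u = <⇒≱ (≤-reflexive len) (Unique-⊆-length uS (absorb ∘ S⊆a∷u))
    where
    absorb : a ∷ u ⊆ u
    absorb (here refl) = a∈u
    absorb (there s∈)  = s∈
  len′ : length u ≡ length (rem a S)
  len′ = suc-injective (trans len (length-rem uS a∈S))
  u⊆ : u ⊆ rem a S
  u⊆ x∈u = ∈-rem⁺ S (a∷u⊆S (there x∈u)) (λ { refl → a∉u x∈u })
  rem⊆ : rem a S ⊆ u
  rem⊆ y∈ = ∈-tail (S⊆a∷u (proj₁ (∈-rem⁻ S y∈))) (proj₂ (∈-rem⁻ S y∈))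

arrangement-∷⁺ : ∀ {S a u} → Unique S → a ∈ S → Arrangement (rem a S) u → Arrangement S (a ∷ u)
arrangement-∷⁺ {S} {a} {u} uS a∈S (len , u⊆ , rem⊆) = trans (cong suc len) (sym (length-rem uS a∈S)) , a∷u⊆ , S⊆
  where
  a∷u⊆ : a ∷ u ⊆ S
  a∷u⊆ (here refl) = a∈S
  a∷u⊆ (there x∈u) = proj₁ (∈-rem⁻ S (u⊆ x∈u))
  S⊆ : S ⊆ a ∷ u
  S⊆ {x} x∈S with x ≟ a
  ... | yes refl = here refl
  ... | no  x≢a  = there (rem⊆ (∈-rem⁺ S x∈S x≢a))

isArrangement-∷ : ∀ S a u → Unique S → isArrangement S (a ∷ u) ≡ memb a S ∧ isArrangement (rem a S) u
isArrangement-∷ S a u uS = T-ext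
  (λ t → let a∈S , arr = arrangement-∷⁻ uS (isArrangement⁻ S (a ∷ u) t)
         in ∧⁺ (memb⁺ S a∈S) (isArrangement⁺ (rem a S) u arr))
  (λ t → let a∈S , arr = ∧⁻ t
         in isArrangement⁺ S (a ∷ u) (arrangement-∷⁺ uS (memb⁻ S a∈S) (isArrangement⁻ (rem a S) u arr)))

sumOver-memb : ∀ xs S → Unique xs → Unique S → S ⊆ xs → sumOver xs (λ a → ind (memb a S)) ≡ length S
sumOver-memb xs S ux uS S⊆xs =
  trans (sym (length-filter (λ a → memb a S) xs)) (Unique-same-length (Unique.filter⁺ (T? ∘ (λ a → memb a S)) ux) uS F⊆S S⊆F)
  where
  F⊆S : filterᵇ (λ a → memb a S) xs ⊆ S
  F⊆S a∈F = memb⁻ S (proj₂ (∈-filter⁻ (T? ∘ (λ a → memb a S)) {xs = xs} a∈F))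
  S⊆F : S ⊆ filterᵇ (λ a → memb a S) xs
  S⊆F a∈S = ∈-filter⁺ (T? ∘ (λ a → memb a S)) (S⊆xs a∈S) (memb⁺ S a∈S)

count-arrangements : ∀ n L S → length S ≡ L → Unique S → S ⊆ oneTo n →
  sumWords n L (ind ∘ isArrangement S) ≡ L !
count-arrangements n zero    []      refl _  _   = refl
count-arrangements n (suc L) S       len  uS S⊆n = begin
  sumWords n (suc L) (ind ∘ isArrangement S)
    ≡⟨ sumWords-suc n L _ ⟩
  sumOver (oneTo n) (λ a → sumWords n L (λ u → ind (isArrangement S (a ∷ u))))
    ≡⟨ sumOver-cong (oneTo n) (λ {a} _ → sumOver-cong (words L n) (λ {u} _ → cong ind (isArrangement-∷ S a u uS))) ⟩
  sumOver (oneTo n) (λ a → sumWords n L (λ u → ind (memb a S ∧ isArrangement (rem a S) u)))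
    ≡⟨ sumOver-cong (oneTo n) (λ {a} _ → first-letter a) ⟩
  sumOver (oneTo n) (λ a → ind (memb a S) * L !)
    ≡⟨ sumOver-*ʳ (oneTo n) (λ a → ind (memb a S)) (L !) ⟩
  sumOver (oneTo n) (λ a → ind (memb a S)) * L !
    ≡⟨ cong (_* L !) (trans (sumOver-memb (oneTo n) S (oneTo-Unique n) uS S⊆n) len) ⟩
  suc L ! ∎
  where
  open ≡-Reasoning
  first-letter : ∀ a → sumWords n L (λ u → ind (memb a S ∧ isArrangement (rem a S) u)) ≡ ind (memb a S) * L !
  first-letter a with memb a S in a∈?
  ... | false = sumOver-zero (words L n) (λ _ → refl)
  ... | true  = trans (count-arrangements n L (rem a S) len′ (rem-Unique uS) (S⊆n ∘ proj₁ ∘ ∈-rem⁻ S))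
                      (sym (+-identityʳ _))
    where
    len′ : length (rem a S) ≡ L
    len′ = suc-injective (trans (sym (length-rem uS (memb⁻ S (subst T (sym a∈?) _)))) len)

module Cut (α β : List ℕ) (above : ∀ {x z} → x ∈ α → z ∈ β → z < x)
           (α++β⊆ : α ++ β ⊆ interval 0 (length α + length β))
           (⊆α++β : interval 0 (length α + length β) ⊆ α ++ β) where

  a b m : ℕ
  a = length α
  b = length β
  m = a + b

  in-range : ∀ {x} → x ∈ α ++ β → 0 < x × x ≤ m
  in-range x∈ = ∈-interval⁻ 0 m (α++β⊆ x∈)

  which-part : ∀ {v} → 0 < v → v ≤ m → v ∈ α ⊎ v ∈ β
  which-part 0<v v≤m = ∈-++⁻ α (⊆α++β (∈-interval⁺ 0 m 0<v v≤m))

  -- an entry z of β is at most b, as all of 1..z lie in β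
  β-small : ∀ {z} → z ∈ β → z ≤ b
  β-small {z} z∈β = subst (_≤ b) (length-interval 0 z) (Unique-⊆-length (interval-Unique 0 z) below⊆β)
    where
    below⊆β : interval 0 z ⊆ β
    below⊆β v∈ with 0<v , v≤z ← ∈-interval⁻ 0 z v∈
      with which-part 0<v (≤-trans v≤z (proj₂ (in-range (∈-++⁺ʳ α z∈β))))
    ... | inj₁ v∈α = ⊥-elim (<⇒≱ (above v∈α z∈β) v≤z)
    ... | inj₂ v∈β = v∈β

  -- an entry x of α exceeds b, as all of x..m lie in α
  α-large : ∀ {x} → x ∈ α → b < x
  α-large {zero}   x∈α = ⊥-elim (<-irrefl refl (proj₁ (in-range (∈-++⁺ˡ x∈α))))
  α-large {suc x′} x∈α = s≤s b≤x′
    where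
    x′≤m : x′ ≤ m
    x′≤m = <⇒≤ (proj₂ (in-range (∈-++⁺ˡ x∈α)))
    c : ℕ
    c = proj₁ (m≤n⇒∃[o]m+o≡n x′≤m)
    x′+c≡m : x′ + c ≡ m
    x′+c≡m = proj₂ (m≤n⇒∃[o]m+o≡n x′≤m)
    above⊆α : interval x′ c ⊆ α
    above⊆α v∈ with x′<v , v≤ ← ∈-interval⁻ x′ c v∈
      with which-part (≤-<-trans z≤n x′<v) (≤-trans v≤ (≤-reflexive x′+c≡m))
    ... | inj₁ v∈α = v∈α
    ... | inj₂ v∈β = ⊥-elim (<⇒≱ (above x∈α v∈β) x′<v)
    c≤a : c ≤ a
    c≤a = subst (_≤ a) (length-interval x′ c) (Unique-⊆-length (interval-Unique x′ c) above⊆α)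
    b≤x′ : b ≤ x′
    b≤x′ = +-cancelʳ-≤ a b x′ (begin
      b + a   ≡⟨ +-comm b a ⟩
      m       ≡⟨ x′+c≡m ⟨
      x′ + c  ≤⟨ +-monoʳ-≤ x′ c≤a ⟩
      x′ + a  ∎)
      where open ≤-Reasoning

  cut : Arrangement (interval (length β) (length α)) α × Arrangement (interval 0 (length β)) β
  cut = (sym (length-interval b a) , α⊆top , top⊆α) , (sym (length-interval 0 b) , β⊆bottom , bottom⊆β)
    where
    α⊆top : α ⊆ interval b a
    α⊆top x∈α = ∈-interval⁺ b a (α-large x∈α) (≤-trans (proj₂ (in-range (∈-++⁺ˡ x∈α))) (≤-reflexive (+-comm a b)))
    top⊆α : interval b a ⊆ α
    top⊆α v∈ with b<v , v≤ ← ∈-interval⁻ b a v∈ with which-part (≤-<-trans z≤n b<v) (≤-trans v≤ (≤-reflexive (+-comm b a)))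
    ... | inj₁ v∈α = v∈α
    ... | inj₂ v∈β = ⊥-elim (<⇒≱ b<v (β-small v∈β))
    β⊆bottom : β ⊆ interval 0 b
    β⊆bottom z∈β = ∈-interval⁺ 0 b (proj₁ (in-range (∈-++⁺ʳ α z∈β))) (β-small z∈β)
    bottom⊆β : interval 0 b ⊆ β
    bottom⊆β v∈ with 0<v , v≤b ← ∈-interval⁻ 0 b v∈ with which-part 0<v (≤-trans v≤b (m≤n+m b a))
    ... | inj₁ v∈α = ⊥-elim (<⇒≱ (α-large v∈α) v≤b)
    ... | inj₂ v∈β = v∈β

at-∈ : ∀ α {q} → q < length α → at α q ∈ α
at-∈ (x ∷ α) {zero}  _         = here refl
at-∈ (x ∷ α) {suc q} (s≤s q<) = there (at-∈ α q<)

∈-at : ∀ {x} α → x ∈ α → ∃ λ q → q < length α × at α q ≡ x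
∈-at (y ∷ α) (here refl) = 0 , s≤s z≤n , refl
∈-at (y ∷ α) (there x∈) with q , q< , eq ← ∈-at α x∈ = suc q , s≤s q< , eq

at-++ˡ : ∀ α r {q} → q < length α → at (α ++ r) q ≡ at α q
at-++ˡ (x ∷ α) r {zero}  _        = refl
at-++ˡ (x ∷ α) r {suc q} (s≤s q<) = at-++ˡ α r q<

at-++ʳ : ∀ α r q → at (α ++ r) (length α + q) ≡ at r q
at-++ʳ []      r q = refl
at-++ʳ (x ∷ α) r q = at-++ʳ α r q

at-middle : ∀ α y β → at (α ++ y ∷ β) (length α) ≡ y
at-middle []      y β = refl
at-middle (x ∷ α) y β = at-middle α y β

at-left : ∀ α r {q} → q < length α → at (α ++ r) q ∈ α
at-left α r q< = subst (_∈ α) (sym (at-++ˡ α r q<)) (at-∈ α q<)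

at-right : ∀ α y β {q} → length α < q → q < length (α ++ y ∷ β) → at (α ++ y ∷ β) q ∈ β
at-right []      y β {suc q} _        (s≤s q<) = at-∈ β q<
at-right (x ∷ α) y β {suc q} (s≤s a<) (s≤s q<) = at-right α y β a< q<

take-length-++ : ∀ (α r : List ℕ) → take (length α) (α ++ r) ≡ α
take-length-++ []      r = refl
take-length-++ (x ∷ α) r = cong (x ∷_) (take-length-++ α r)

drop-length-++ : ∀ (α r : List ℕ) → drop (length α) (α ++ r) ≡ r
drop-length-++ []      r = refl
drop-length-++ (x ∷ α) r = drop-length-++ α r

orderIso-entry : ∀ u σ → T (orderIso u σ) → ∀ {a b} → a < length σ → b < length σ →
  T ((at u a <ᵇ at u b) == (at σ a <ᵇ at σ b))
orderIso-entry u σ t a<k b<k =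
  All.lookup (all⁺ _ _ (All.lookup (all⁺ _ _ (proj₂ (∧⁻ {length u ≡ᵇ length σ} t))) (∈-upTo⁺ a<k))) (∈-upTo⁺ b<k)

is132 : ℕ → ℕ → ℕ → Bool
is132 x y z = orderIso (x ∷ y ∷ z ∷ []) (1 ∷ 3 ∷ 2 ∷ [])

is132⁻ : ∀ {x y z} → T (is132 x y z) → x < z × z < y
is132⁻ {x} {y} {z} t = <ᵇ⇒< x z (agrees-with-true (entry {0} {2} (s≤s z≤n) (s≤s (s≤s (s≤s z≤n)))))
                     , <ᵇ⇒< z y (agrees-with-true (entry {2} {1} (s≤s (s≤s (s≤s z≤n))) (s≤s (s≤s z≤n))))
  where
  entry : ∀ {a b} → a < 3 → b < 3 →
    T ((at (x ∷ y ∷ z ∷ []) a <ᵇ at (x ∷ y ∷ z ∷ []) b) == (at (1 ∷ 3 ∷ 2 ∷ []) a <ᵇ at (1 ∷ 3 ∷ 2 ∷ []) b))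
  entry = orderIso-entry (x ∷ y ∷ z ∷ []) (1 ∷ 3 ∷ 2 ∷ []) t
  agrees-with-true : ∀ {b} → T (b == true) → T b
  agrees-with-true {true} _ = _

is132⁺ : ∀ {x y z} → x < z → z < y → T (is132 x y z)
is132⁺ {x} {y} {z} x<z z<y
  rewrite <ᵇ-false {x} ≤-refl | <ᵇ-false {y} ≤-refl | <ᵇ-false {z} ≤-refl
        | <ᵇ-true (<-trans x<z z<y) | <ᵇ-true x<z | <ᵇ-true z<y
        | <ᵇ-false {y} (<⇒≤ (<-trans x<z z<y)) | <ᵇ-false {z} (<⇒≤ x<z) | <ᵇ-false {y} (<⇒≤ z<y) = _

sort-132 : ∀ {x y z} → x < z → z < y → sortℕ (x ∷ y ∷ z ∷ []) ≡ x ∷ z ∷ y ∷ []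
sort-132 {x} {y} {z} x<z z<y
  rewrite T-false (λ t → <⇒≱ z<y (≤ᵇ⇒≤ y z t)) | T-true (≤⇒≤ᵇ (<⇒≤ x<z)) = refl

-- what contains tests, for p132-3 and p132-13, on the values (x, y, z) read at positions i < j < l
match-132-3 : ℕ → ℕ → ℕ → ℕ → Bool
match-132-3 n x y z = is132 x y z ∧ true ∧ (adjacentAt (ext (sortℕ (x ∷ y ∷ z ∷ [])) n) 3 ∧ true)

match-132-13 : ℕ → ℕ → ℕ → ℕ → Bool
match-132-13 n x y z = is132 x y z ∧ true ∧
  (adjacentAt (ext (sortℕ (x ∷ y ∷ z ∷ [])) n) 1 ∧ (adjacentAt (ext (sortℕ (x ∷ y ∷ z ∷ [])) n) 3 ∧ true))

match-132-3⁻ : ∀ {n x y z} → T (match-132-3 n x y z) → x < z × z < y × y ≡ n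
match-132-3⁻ {n} {x} {y} {z} t with x<z , z<y ← is132⁻ (proj₁ (∧⁻ {is132 x y z} t)) =
  x<z , z<y , sym (≡ᵇ⇒≡ n y (proj₁ (∧⁻ top-is-n)))
  where
  -- after sorting, the test for y = 3 compares n + 1 with y + 1
  top-is-n : T (adjacentAt (ext (x ∷ z ∷ y ∷ []) n) 3 ∧ true)
  top-is-n = subst (λ s → T (adjacentAt (ext s n) 3 ∧ true)) (sort-132 x<z z<y) (proj₂ (∧⁻ {is132 x y z} t))

match-132-3⁺ : ∀ {n x y z} → x < z → z < y → y ≡ n → T (match-132-3 n x y z)
match-132-3⁺ {n} {x} {y} {z} x<z z<y refl rewrite sort-132 x<z z<y =
  ∧⁺ (is132⁺ x<z z<y) (∧⁺ (≡⇒≡ᵇ y y refl) _)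

match-132-13⁺ : ∀ {n x y z} → x < z → z < y → y ≡ n → z ≡ suc x → T (match-132-13 n x y z)
match-132-13⁺ {n} {x} {y} {z} x<z z<y refl z≡1+x rewrite sort-132 x<z z<y =
  ∧⁺ (is132⁺ x<z z<y) (∧⁺ (≡⇒≡ᵇ z (suc x) z≡1+x) (∧⁺ (≡⇒≡ᵇ y y refl) _))

match-132-13⇒3 : ∀ {n x y z} → T (match-132-13 n x y z) → T (match-132-3 n x y z)
match-132-13⇒3 {n} {x} {y} {z} t with first , rest ← ∧⁻ {is132 x y z} t =
  ∧⁺ first (proj₂ (∧⁻ {adjacentAt (ext (sortℕ (x ∷ y ∷ z ∷ [])) n) 1} rest))

interval-sublist⁻ : ∀ lo c {is} → is ⊑ interval lo c → Linked _<_ (lo ∷ is) × All (_≤ lo + c) is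
interval-sublist⁻ lo zero    []         = [-] , []
interval-sublist⁻ lo (suc c) (_ ∷ʳ sub) with inc , bnd ← interval-sublist⁻ (suc lo) c sub =
  lower-start inc , All.map (λ p → ≤-trans p (≤-reflexive (sym (+-suc lo c)))) bnd
  where
  lower-start : ∀ {is} → Linked _<_ (suc lo ∷ is) → Linked _<_ (lo ∷ is)
  lower-start [-]       = [-]
  lower-start (p ∷ inc) = <-trans (n<1+n lo) p ∷ inc
interval-sublist⁻ lo (suc c) (refl ∷ sub) with inc , bnd ← interval-sublist⁻ (suc lo) c sub =
  n<1+n lo ∷ inc , proj₂ (∈-interval⁻ lo (suc c) (here refl)) ∷ All.map (λ p → ≤-trans p (≤-reflexive (sym (+-suc lo c)))) bnd

interval-sublist⁺ : ∀ lo c is → Linked _<_ (lo ∷ is) → All (_≤ lo + c) is → is ⊑ interval lo c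
interval-sublist⁺ lo c       []       _             _          = minimum _
interval-sublist⁺ lo zero    (x ∷ is) (lo<x ∷ _)    (x≤ ∷ _)   = ⊥-elim (<⇒≱ lo<x (subst (x ≤_) (+-identityʳ lo) x≤))
interval-sublist⁺ lo (suc c) (x ∷ is) (lo<x ∷ inc) bnd with x ≟ suc lo
... | yes refl = refl ∷ interval-sublist⁺ (suc lo) c is inc (All.map (λ p → ≤-trans p (≤-reflexive (+-suc lo c))) (All.tail bnd))
... | no  x≢   = suc lo ∷ʳ interval-sublist⁺ (suc lo) c (x ∷ is) (≤∧≢⇒< lo<x (x≢ ∘ sym) ∷ inc)
                                              (All.map (λ p → ≤-trans p (≤-reflexive (+-suc lo c))) bnd)

∈-combs⁻ : ∀ k xs {is} → is ∈ combs k xs → is ⊑ xs × length is ≡ k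
∈-combs⁻ zero    xs       (here refl) = minimum xs , refl
∈-combs⁻ (suc k) (x ∷ xs) is∈ with ∈-++⁻ (map (x ∷_) (combs k xs)) is∈
... | inj₁ is∈₁ with is′ , is′∈ , refl ← ∈-map⁻ (x ∷_) is∈₁ with sub , len ← ∈-combs⁻ k xs is′∈ = refl ∷ sub , cong suc len
... | inj₂ is∈₂ with sub , len ← ∈-combs⁻ (suc k) xs is∈₂ = x ∷ʳ sub , len

∈-combs⁺ : ∀ {is xs} → is ⊑ xs → is ∈ combs (length is) xs
∈-combs⁺ {[]}     _                 = here refl
∈-combs⁺ {i ∷ is} (x ∷ʳ sub)        = ∈-++⁺ʳ (map (x ∷_) (combs (length is) _)) (∈-combs⁺ sub)
∈-combs⁺ {i ∷ is} (refl ∷ sub)      = ∈-++⁺ˡ (∈-map⁺ (i ∷_) (∈-combs⁺ sub))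

Triple : ℕ → ℕ → ℕ → ℕ → Set
Triple n i j l = 0 < i × i < j × j < l × l ≤ n

∈-triples⁻ : ∀ n {is} → is ∈ combs 3 (oneTo n) → ∃ λ i → ∃ λ j → ∃ λ l → is ≡ i ∷ j ∷ l ∷ [] × Triple n i j l
∈-triples⁻ n {is} is∈ with ∈-combs⁻ 3 (oneTo n) is∈
... | sub , len with is | len
... | i ∷ j ∷ l ∷ [] | refl with interval-sublist⁻ 0 n (subst (_ ⊑_) (oneTo-interval n) sub)
... | 0<i ∷ i<j ∷ j<l ∷ [-] , _ ∷ _ ∷ l≤n ∷ [] = i , j , l , refl , 0<i , i<j , j<l , l≤n

∈-triples⁺ : ∀ {n i j l} → Triple n i j l → (i ∷ j ∷ l ∷ []) ∈ combs 3 (oneTo n)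
∈-triples⁺ {n} {i} {j} {l} (0<i , i<j , j<l , l≤n) =
  subst (λ xs → _ ∈ combs 3 xs) (sym (oneTo-interval n))
    (∈-combs⁺ (interval-sublist⁺ 0 n _ (0<i ∷ i<j ∷ j<l ∷ [-]) (i≤n ∷ j≤n ∷ l≤n ∷ [])))
  where
  j≤n : j ≤ n
  j≤n = ≤-trans (<⇒≤ j<l) l≤n
  i≤n : i ≤ n
  i≤n = ≤-trans (<⇒≤ i<j) j≤n

record Occurrence (n : ℕ) (w : List ℕ) : Set where
  constructor occurrence
  field
    i j l  : ℕ
    triple : Triple n i j l
    wᵢ<wₗ  : pos w i < pos w l
    wₗ<wⱼ  : pos w l < pos w j
    wⱼ≡n   : pos w j ≡ n

contains-132-3⁻ : ∀ n w → T (contains n w p132-3) → Occurrence n w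
contains-132-3⁻ n w t with is , is∈ , match ← find (any⁻ _ _ t) with i , j , l , refl , tri ← ∈-triples⁻ n is∈
  with x<z , z<y , y≡n ← match-132-3⁻ {n} {pos w i} {pos w j} {pos w l} match = occurrence i j l tri x<z z<y y≡n

contains-132-3⁺ : ∀ n w → Occurrence n w → T (contains n w p132-3)
contains-132-3⁺ n w (occurrence i j l tri x<z z<y y≡n) = any⁺ _ (lose (∈-triples⁺ tri) (match-132-3⁺ x<z z<y y≡n))

contains-132-13⁺ : ∀ n w (o : Occurrence n w) → let open Occurrence o in pos w l ≡ suc (pos w i) →
  T (contains n w p132-13)
contains-132-13⁺ n w (occurrence i j l tri x<z z<y y≡n) z≡1+x =
  any⁺ _ (lose (∈-triples⁺ tri) (match-132-13⁺ x<z z<y y≡n z≡1+x))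

contains-132-13⇒3 : ∀ n w → T (contains n w p132-13) → T (contains n w p132-3)
contains-132-13⇒3 n w t with is , is∈ , match ← find (any⁻ _ _ t) with i , j , l , refl , _ ← ∈-triples⁻ n is∈ =
  any⁺ _ (lose is∈ (match-132-13⇒3 {n} {pos w i} {pos w j} {pos w l} match))

IsPerm : ℕ → List ℕ → Set
IsPerm n w = length w ≡ n × oneTo n ⊆ w

isPermOf⁻ : ∀ n w → T (isPermOf n w) → IsPerm n w
isPermOf⁻ n w t with len , cov ← ∧⁻ {length w ≡ᵇ n} t = ≡ᵇ⇒≡ _ _ len , memb⁻ w ∘ All.lookup (all⁺ _ (oneTo n) cov)

isPermOf⁺ : ∀ n w → IsPerm n w → T (isPermOf n w)
isPermOf⁺ n w (len , cov) = ∧⁺ (≡⇒≡ᵇ _ _ len) (all⁻ _ (All.tabulate (memb⁺ w ∘ cov)))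

perm-Unique : ∀ n w → IsPerm n w → Unique w
perm-Unique n w (len , cov) = covering-Unique w (oneTo-Unique n) cov (≤-reflexive (trans len (sym length-oneTo)))
  where
  length-oneTo : length (oneTo n) ≡ n
  length-oneTo = trans (length-map suc (upTo n)) (length-upTo n)

-- The two patterns have the same avoiders

-- In a permutation every occurrence of (132, ∅, {3}) can be tightened into one of (132, ∅, {1,3}):
-- if w_l ≠ w_i + 1, the value w_i + 1 < w_l occurs somewhere; left of n it replaces w_i, shrinking
-- the gap w_l − w_i, and right of n it replaces w_l, making the gap 1.
tighten : ∀ n w → IsPerm n w → Occurrence n w → T (contains n w p132-13)
tighten n w (len , cov) (occurrence i j l (0<i , i<j , j<l , l≤n) wᵢ<wₗ wₗ<wⱼ wⱼ≡n) = go _ i 0<i i<j wᵢ<wₗ refl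
  where
  z : ℕ
  z = pos w l
  z<n : z < n
  z<n = subst (z <_) wⱼ≡n wₗ<wⱼ
  go : ∀ d k → 0 < k → k < j → pos w k < z → z ∸ pos w k ≡ d → T (contains n w p132-13)
  go zero    k _   _   x<z gap = ⊥-elim (<-irrefl (sym gap) (m<n⇒0<n∸m x<z))
  go (suc d) k 0<k k<j x<z gap with suc (pos w k) ≟ z
  ... | yes x+1≡z = contains-132-13⁺ n w (occurrence k j l (0<k , k<j , j<l , l≤n) x<z wₗ<wⱼ wⱼ≡n) (sym x+1≡z)
  ... | no  x+1≢z = move (≤∧≢⇒< x<z x+1≢z) (∈-at w (cov (∈-oneTo⁺ (s≤s z≤n , <⇒≤ (<-trans (≤∧≢⇒< x<z x+1≢z) z<n)))))
    where
    -- the value w_k + 1 sits at position q + 1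
    move : suc (pos w k) < z → (∃ λ q → q < length w × at w q ≡ suc (pos w k)) → T (contains n w p132-13)
    move x+1<z (q , q<len , wq≡x+1) with <-cmp (suc q) j
    ... | tri< q+1<j _ _ = go d (suc q) (s≤s z≤n) q+1<j (subst (_< z) (sym wq≡x+1) x+1<z) gap′
      where
      gap′ : z ∸ at w q ≡ d
      gap′ = trans (cong (z ∸_) wq≡x+1) (trans (sym (pred[m∸n]≡m∸[1+n] z (pos w k))) (cong pred gap))
    ... | tri≈ _ q+1≡j _ =
      ⊥-elim (<-irrefl (trans (sym (subst (λ p → pos w p ≡ suc (pos w k)) q+1≡j wq≡x+1)) wⱼ≡n) (<-trans x+1<z z<n))
    ... | tri> _ _ j<q+1 = contains-132-13⁺ n w
      (occurrence k j (suc q) (0<k , k<j , j<q+1 , subst (suc q ≤_) len q<len)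
         (subst (pos w k <_) (sym wq≡x+1) ≤-refl) (subst₂ _<_ (sym wq≡x+1) (sym wⱼ≡n) (<-trans x+1<z z<n)) wⱼ≡n)
      wq≡x+1

contains-132-3⇔13 : ∀ n w → IsPerm n w → contains n w p132-3 ≡ contains n w p132-13
contains-132-3⇔13 n w perm = T-ext (tighten n w perm ∘ contains-132-3⁻ n w) (contains-132-13⇒3 n w)

avoids : ℕ → List ℕ → Bool
avoids n w = isPermOf n w ∧ not (contains n w p132-3)

-- if n occurs in neither α nor β, an occurrence in α ++ n ∷ β has its '3' at position |α| + 1,
-- hence its '1' in α and its '2' in β
occurrence-sides : ∀ {n} α β → n ∉ α → n ∉ β → length (α ++ n ∷ β) ≡ n → (o : Occurrence n (α ++ n ∷ β)) →
  let open Occurrence o in pos (α ++ n ∷ β) i ∈ α × pos (α ++ n ∷ β) l ∈ β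
occurrence-sides {n} α β n∉α n∉β len (occurrence i j l (0<i , i<j , j<l , l≤n) _ _ wⱼ≡n)
  with <-cmp (j ∸ 1) (length α)
... | tri< j′<a _ _ = ⊥-elim (n∉α (subst (_∈ α) wⱼ≡n (at-left α _ j′<a)))
... | tri> _ _ a<j′ = ⊥-elim (n∉β (subst (_∈ β) wⱼ≡n (at-right α n β a<j′ (<-≤-trans (≤-<-trans (m∸n≤m j 1) j<l) l≤|w|))))
  where l≤|w| = ≤-trans l≤n (≤-reflexive (sym len))
... | tri≈ _ j′≡a _ =
  at-left α _ (subst (i ∸ 1 <_) j′≡a (∸-monoˡ-< i<j 0<i)) ,
  at-right α n β (subst (_< l ∸ 1) j′≡a (∸-monoˡ-< j<l (<-trans 0<i i<j)))
                 (<-≤-trans (∸-monoʳ-< {l} {1} {0} (s≤s z≤n) (<-trans (<-trans 0<i i<j) j<l)) (≤-trans l≤n (≤-reflexive (sym len))))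

blocks⇒avoids : ∀ α β → Arrangement (interval (length β) (length α)) α → Arrangement (interval 0 (length β)) β →
  T (avoids (length α + suc (length β)) (α ++ (length α + suc (length β)) ∷ β))
blocks⇒avoids α β (_ , α⊆ , ⊆α) (_ , β⊆ , ⊆β) = ∧⁺ (isPermOf⁺ n w (len , cov)) (T-not no-occurrence)
  where
  a b n : ℕ
  a = length α
  b = length β
  n = a + suc b
  w : List ℕ
  w = α ++ n ∷ β
  n≡ : n ≡ suc (b + a)
  n≡ = trans (+-suc a b) (cong suc (+-comm a b))
  α-bounds : ∀ {x} → x ∈ α → b < x × x ≤ b + a
  α-bounds = ∈-interval⁻ b a ∘ α⊆
  β-bounds : ∀ {z} → z ∈ β → 0 < z × z ≤ b
  β-bounds = ∈-interval⁻ 0 b ∘ β⊆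
  below-n : ∀ {x} → x ≤ b + a → x < n
  below-n x≤ = ≤-trans (s≤s x≤) (≤-reflexive (sym n≡))
  len : length w ≡ n
  len = length-++ α
  cov : oneTo n ⊆ w
  cov {v} v∈ with 0<v , v≤n ← ∈-oneTo⁻ v∈ with v ≟ n | v ≤? b
  ... | yes refl | _      = ∈-++⁺ʳ α (here refl)
  ... | no  _    | yes v≤b = ∈-++⁺ʳ α (there (⊆β (∈-interval⁺ 0 b 0<v v≤b)))
  ... | no  v≢n  | no  v≰b = ∈-++⁺ˡ (⊆α (∈-interval⁺ b a (≰⇒> v≰b) (≤-pred (≤-trans (≤∧≢⇒< v≤n v≢n) (≤-reflexive n≡)))))
  n∉α : n ∉ α
  n∉α n∈α = <-irrefl refl (below-n (proj₂ (α-bounds n∈α)))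
  n∉β : n ∉ β
  n∉β n∈β = <-irrefl refl (below-n (≤-trans (proj₂ (β-bounds n∈β)) (m≤m+n b a)))
  no-occurrence : ¬ T (contains n w p132-3)
  no-occurrence t with o ← contains-132-3⁻ n w t with x∈α , z∈β ← occurrence-sides α β n∉α n∉β len o =
    <-asym (Occurrence.wᵢ<wₗ o) (≤-<-trans (proj₂ (β-bounds z∈β)) (proj₁ (α-bounds x∈α)))

avoids⇒blocks : ∀ n α β → n ∉ α → All (Letter n) (α ++ n ∷ β) → T (avoids n (α ++ n ∷ β)) →
  Arrangement (interval (length β) (length α)) α × Arrangement (interval 0 (length β)) β
avoids⇒blocks n α β n∉α letters t = Cut.cut α β above α++β⊆ ⊆α++β
  where
  w : List ℕ
  w = α ++ n ∷ β
  a b : ℕ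
  a = length α
  b = length β
  perm : IsPerm n w
  perm = isPermOf⁻ n w (proj₁ (∧⁻ {isPermOf n w} t))
  avoid : ¬ T (contains n w p132-3)
  avoid = T-not⁻ (proj₂ (∧⁻ {isPermOf n w} t))
  n∉β : n ∉ β
  n∉β = proj₁ (proj₂ (Unique-middle α β (perm-Unique n w perm)))
  disjoint : ∀ {x} → x ∈ α → x ∉ β
  disjoint = proj₂ (proj₂ (Unique-middle α β (perm-Unique n w perm)))
  n≡ : n ≡ suc (a + b)
  n≡ = trans (sym (proj₁ perm)) (trans (length-++ α) (+-suc a b))
  α++β⊆ : α ++ β ⊆ interval 0 (a + b)
  α++β⊆ {x} x∈ with 0<x , x≤n ← All.lookup letters (∈-insert-middle α x∈) =
    ∈-interval⁺ 0 (a + b) 0<x (≤-pred (≤-trans (≤∧≢⇒< x≤n x≢n) (≤-reflexive n≡)))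
    where
    x≢n : x ≢ n
    x≢n refl with ∈-++⁻ α x∈
    ... | inj₁ n∈α = n∉α n∈α
    ... | inj₂ n∈β = n∉β n∈β
  ⊆α++β : interval 0 (a + b) ⊆ α ++ β
  ⊆α++β v∈ with 0<v , v≤ ← ∈-interval⁻ 0 (a + b) v∈ =
    ∈-delete-middle α (proj₂ perm (∈-oneTo⁺ (0<v , ≤-trans v≤ (≤-trans (n≤1+n _) (≤-reflexive (sym n≡))))))
                      (λ v≡n → 1+n≰n (subst (_≤ a + b) (trans v≡n n≡) v≤))
  -- x < z for x in α and z in β would give the occurrence x, n, z
  above : ∀ {x z} → x ∈ α → z ∈ β → z < x
  above {x} {z} x∈α z∈β with <-cmp x z
  ... | tri> _ _ z<x = z<x
  ... | tri≈ _ refl _ = ⊥-elim (disjoint x∈α z∈β)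
  ... | tri< x<z _ _ with q₁ , q₁< , αq₁≡x ← ∈-at α x∈α | q₂ , q₂< , βq₂≡z ← ∈-at β z∈β =
    ⊥-elim (avoid (contains-132-3⁺ n w (occurrence (suc q₁) (suc a) (suc (a + suc q₂)) positions wᵢ<wₗ wₗ<wⱼ wⱼ≡n)))
    where
    wᵢ≡x : at w q₁ ≡ x
    wᵢ≡x = trans (at-++ˡ α (n ∷ β) q₁<) αq₁≡x
    wₗ≡z : at w (a + suc q₂) ≡ z
    wₗ≡z = trans (at-++ʳ α (n ∷ β) (suc q₂)) βq₂≡z
    wⱼ≡n : at w a ≡ n
    wⱼ≡n = at-middle α n β
    z<n : z < n
    z<n = ≤∧≢⇒< (proj₂ (All.lookup letters (∈-++⁺ʳ α (there z∈β)))) (λ { refl → n∉β z∈β })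
    wᵢ<wₗ : at w q₁ < at w (a + suc q₂)
    wᵢ<wₗ = subst₂ _<_ (sym wᵢ≡x) (sym wₗ≡z) x<z
    wₗ<wⱼ : at w (a + suc q₂) < at w a
    wₗ<wⱼ = subst₂ _<_ (sym wₗ≡z) (sym wⱼ≡n) z<n
    positions : Triple n (suc q₁) (suc a) (suc (a + suc q₂))
    positions = s≤s z≤n , s≤s q₁< , s≤s (m<m+n a (s≤s z≤n)) ,
      ≤-trans (≤-reflexive (sym (+-suc a (suc q₂)))) (≤-trans (+-monoʳ-≤ a (s≤s q₂<)) (≤-reflexive (trans (+-suc a b) (sym n≡))))

-- Counting avoiders by the position of n

afterTop : ℕ → ℕ → List ℕ → Bool
afterTop n k v = isArrangement [ n ] (take 1 v) ∧ isArrangement (interval 0 (n ∸ k)) (drop 1 v)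

-- w has shape k: an arrangement of the top block [n−k+1 .. n−1], then n (at position k), then afterTop
shape : ℕ → ℕ → List ℕ → Bool
shape n k w = isArrangement (interval (n ∸ k) (k ∸ 1)) (take (k ∸ 1) w) ∧ afterTop n k (drop (k ∸ 1) w)

count-shape : ∀ n k → Letter n k → sumWords n n (ind ∘ shape n k) ≡ (k ∸ 1) ! * (n ∸ k) !
count-shape n (suc a) (_ , k≤n) = begin
  sumWords n n (ind ∘ shape n (suc a))
    ≡⟨ cong (λ L → sumWords n L (ind ∘ shape n (suc a))) n≡ ⟨
  sumWords n (a + suc b) (ind ∘ shape n (suc a))
    ≡⟨ sumWords-product n a (suc b) (isArrangement top) (afterTop n (suc a)) ⟩
  sumWords n a (ind ∘ isArrangement top) * sumWords n (1 + b) (ind ∘ afterTop n (suc a))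
    ≡⟨ cong (sumWords n a (ind ∘ isArrangement top) *_)
            (sumWords-product n 1 b (isArrangement [ n ]) (isArrangement bottom)) ⟩
  sumWords n a (ind ∘ isArrangement top) * (sumWords n 1 (ind ∘ isArrangement [ n ]) * sumWords n b (ind ∘ isArrangement bottom))
    ≡⟨ cong₂ _*_ (count-arrangements n a top (length-interval b a) (interval-Unique b a) top⊆)
                 (cong₂ _*_ (count-arrangements n 1 [ n ] refl ([] ∷ []) n∈)
                            (count-arrangements n b bottom (length-interval 0 b) (interval-Unique 0 b) bottom⊆)) ⟩
  a ! * (1 * b !)
    ≡⟨ cong (a ! *_) (*-identityˡ (b !)) ⟩
  a ! * b !  ∎
  where
  open ≡-Reasoning
  b : ℕ
  b = n ∸ suc a
  top bottom : List ℕ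
  top = interval b a
  bottom = interval 0 b
  n≡ : a + suc b ≡ n
  n≡ = trans (+-suc a b) (m+[n∸m]≡n k≤n)
  top⊆ : top ⊆ oneTo n
  top⊆ x∈ with b<x , x≤ ← ∈-interval⁻ b a x∈ =
    ∈-oneTo⁺ (≤-<-trans z≤n b<x , ≤-trans x≤ (≤-trans (≤-reflexive (+-comm b a)) (≤-trans (+-monoʳ-≤ a (n≤1+n b)) (≤-reflexive n≡))))
  n∈ : [ n ] ⊆ oneTo n
  n∈ (here refl) = ∈-oneTo⁺ (≤-trans (s≤s z≤n) k≤n , ≤-refl)
  bottom⊆ : bottom ⊆ oneTo n
  bottom⊆ x∈ with 0<x , x≤b ← ∈-interval⁻ 0 b x∈ = ∈-oneTo⁺ (0<x , ≤-trans x≤b (m∸n≤m n (suc a)))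

shape⁻ : ∀ n k w → T (shape n k w) → ∃ λ α → ∃ λ β → w ≡ α ++ n ∷ β × length α ≡ k ∸ 1 ×
  Arrangement (interval (length β) (length α)) α × Arrangement (interval 0 (length β)) β
shape⁻ n k w t with topArr , rest ← ∧⁻ {isArrangement (interval (n ∸ k) (k ∸ 1)) (take (k ∸ 1) w)} t
  with nArr , bottomArr ← ∧⁻ {isArrangement [ n ] (take 1 (drop (k ∸ 1) w))} rest
  with drop (k ∸ 1) w in dropEq | isArrangement⁻ [ n ] (take 1 (drop (k ∸ 1) w)) nArr
... | y ∷ β | _ , y∈ , _ with here refl ← y∈ (here refl) =
  α , β , w≡ , lenα ,
  subst₂ (λ lo c → Arrangement (interval lo c) α) (sym lenβ) (sym lenα) arrα ,
  subst (λ c → Arrangement (interval 0 c) β) (sym lenβ) arrβ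
  where
  α : List ℕ
  α = take (k ∸ 1) w
  arrα : Arrangement (interval (n ∸ k) (k ∸ 1)) α
  arrα = isArrangement⁻ _ α topArr
  arrβ : Arrangement (interval 0 (n ∸ k)) β
  arrβ = isArrangement⁻ _ β bottomArr
  lenα : length α ≡ k ∸ 1
  lenα = trans (proj₁ arrα) (length-interval _ _)
  lenβ : length β ≡ n ∸ k
  lenβ = trans (proj₁ arrβ) (length-interval 0 _)
  w≡ : w ≡ α ++ n ∷ β
  w≡ = trans (sym (take++drop≡id (k ∸ 1) w)) (cong (α ++_) dropEq)

shape⁺ : ∀ n α β → n ∸ suc (length α) ≡ length β →
  Arrangement (interval (length β) (length α)) α → Arrangement (interval 0 (length β)) β →
  T (shape n (suc (length α)) (α ++ n ∷ β))
shape⁺ n α β b≡ arrα arrβ rewrite take-length-++ α (n ∷ β) | drop-length-++ α (n ∷ β) | b≡ =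
  ∧⁺ (isArrangement⁺ _ α arrα) (∧⁺ (isArrangement⁺ [ n ] [ n ] (refl , (λ x∈ → x∈) , (λ x∈ → x∈))) (isArrangement⁺ _ β arrβ))

shape⇒avoids : ∀ n k w → length w ≡ n → T (shape n k w) → T (avoids n w)
shape⇒avoids n k w len t with α , β , refl , _ , arrα , arrβ ← shape⁻ n k w t =
  subst (λ m → T (avoids m (α ++ m ∷ β))) (trans (sym (length-++ α)) len) (blocks⇒avoids α β arrα arrβ)

shape-position : ∀ n k α β → n ∉ α → length (α ++ n ∷ β) ≡ n → Letter n k → T (shape n k (α ++ n ∷ β)) →
  k ≡ suc (length α)
shape-position n (suc k′) α β n∉α len _ t with α′ , β′ , eq , lenα′ , (_ , α′⊆ , _) , _ ← shape⁻ n (suc k′) _ t =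
  cong suc (trans (sym lenα′) (sym (first-occurrence α α′ n∉α n∉α′ eq)))
  where
  len′ : length α′ + suc (length β′) ≡ n
  len′ = trans (sym (length-++ α′)) (trans (cong length (sym eq)) len)
  n∉α′ : n ∉ α′
  n∉α′ n∈ = <-irrefl refl (≤-trans (s≤s (proj₂ (∈-interval⁻ (length β′) (length α′) (α′⊆ n∈))))
                                    (≤-reflexive (trans (cong suc (+-comm (length β′) (length α′))) (trans (sym (+-suc _ _)) len′))))

shapes-of : ∀ n w → 1 ≤ n → length w ≡ n → All (Letter n) w →
  sumOver (oneTo n) (λ k → ind (shape n k w)) ≡ ind (avoids n w)
shapes-of n w 1≤n len letters with T? (avoids n w)
... | no ¬avoid =
  trans (sumOver-zero (oneTo n) (λ {k} _ → ind-false (¬avoid ∘ shape⇒avoids n k w len))) (sym (ind-false ¬avoid))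
... | yes avoid with α , β , refl ← ∈-∃++ (proj₂ (isPermOf⁻ n w (proj₁ (∧⁻ {isPermOf n w} avoid))) (∈-oneTo⁺ (1≤n , ≤-refl))) =
  trans (sumOver-single (λ k → shape n k w) (oneTo-Unique n) position∈ (shape⁺ n α β b≡ arrα arrβ)
                        (λ k∈ → shape-position n _ α β n∉α len (∈-oneTo⁻ k∈)))
        (sym (ind-true avoid))
  where
  n∉α : n ∉ α
  n∉α = proj₁ (Unique-middle α β (perm-Unique n w (isPermOf⁻ n w (proj₁ (∧⁻ {isPermOf n w} avoid)))))
  arrα : Arrangement (interval (length β) (length α)) α
  arrα = proj₁ (avoids⇒blocks n α β n∉α letters avoid)
  arrβ : Arrangement (interval 0 (length β)) β
  arrβ = proj₂ (avoids⇒blocks n α β n∉α letters avoid)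
  len′ : length α + suc (length β) ≡ n
  len′ = trans (sym (length-++ α)) len
  b≡ : n ∸ suc (length α) ≡ length β
  b≡ = trans (cong (_∸ suc (length α)) (trans (sym len′) (+-suc (length α) (length β)))) (m+n∸m≡n (suc (length α)) (length β))
  position∈ : suc (length α) ∈ oneTo n
  position∈ = ∈-oneTo⁺ (s≤s z≤n , ≤-trans (s≤s (m≤m+n (length α) (length β))) (≤-reflexive (trans (sym (+-suc _ _)) len′)))

avoidCount-132-3 : ∀ n → 1 ≤ n → avoidCount n p132-3 ≡ rhsSum n
avoidCount-132-3 n 1≤n = begin
  avoidCount n p132-3
    ≡⟨ length-filter² (isPermOf n) (λ w → not (contains n w p132-3)) (words n n) ⟩
  sumWords n n (ind ∘ avoids n)
    ≡⟨ sumWords-cong n n (λ w len letters → sym (shapes-of n w 1≤n len letters)) ⟩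
  sumWords n n (λ w → sumOver (oneTo n) (λ k → ind (shape n k w)))
    ≡⟨ sumOver-swap (words n n) (oneTo n) (λ w k → ind (shape n k w)) ⟩
  sumOver (oneTo n) (λ k → sumWords n n (ind ∘ shape n k))
    ≡⟨ sumOver-cong (oneTo n) (λ {k} k∈ → count-shape n k (∈-oneTo⁻ k∈)) ⟩
  rhsSum n  ∎
  where open ≡-Reasoning

same-avoidCount : ∀ n → avoidCount n p132-3 ≡ avoidCount n p132-13
same-avoidCount n = begin
  avoidCount n p132-3
    ≡⟨ length-filter² (isPermOf n) (λ w → not (contains n w p132-3)) (words n n) ⟩
  sumWords n n (λ w → ind (isPermOf n w ∧ not (contains n w p132-3)))
    ≡⟨ sumOver-cong (words n n) (λ {w} _ → cong ind (same-test w)) ⟩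
  sumWords n n (λ w → ind (isPermOf n w ∧ not (contains n w p132-13)))
    ≡⟨ length-filter² (isPermOf n) (λ w → not (contains n w p132-13)) (words n n) ⟨
  avoidCount n p132-13  ∎
  where
  open ≡-Reasoning
  same-test : ∀ w → isPermOf n w ∧ not (contains n w p132-3) ≡ isPermOf n w ∧ not (contains n w p132-13)
  same-test w with isPermOf n w in isPerm
  ... | false = refl
  ... | true  = cong not (contains-132-3⇔13 n w (isPermOf⁻ n w (subst T (sym isPerm) _)))

mainTheorem8 : (n : ℕ) → n ≥ 1 →
    (avoidCount n p132-3 ≡ avoidCount n p132-13) × (avoidCount n p132-13 ≡ rhsSum n)
mainTheorem8 n 1≤n = same-avoidCount n , trans (sym (same-avoidCount n)) (avoidCount-132-3 n 1≤n)
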